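{- Let $G$ be a connected graph of order $n\ge2$, let $H$ be a graph with $|V(H)|\ge2$, and let $v\in V(H)$. (i) If $v$ does not belong to all maximum independent sets of $H$, then $\alpha(G(H,v))=n\cdot\alpha(H)$. (ii) If $v$ belongs to every maximum independent set of $H$, then $\alpha(G(H,v))=n\cdot(\alpha(H)-1)+\alpha(G)$.
   Context: Graphs are finite, simple, undirected. An independent set is a set of pairwise non-adjacent vertices; $\alpha(G)$ is the maximum size of an independent set and a maximum independent set is one of size $\alpha$. The $G$-concatenation $G(H,v)$ of $H$ on the vertex $v$ is the graph obtained from $G$ by taking, for each vertex $u$ of $G$, a separate copy of $H$ and identifying $u$ with the copy of $v$ in that copy of $H$. -}

module Defs where

open import Data.Nat using (ℕ; _*_; _≤_)
open import Data.Fin using (Fin; remQuot; _≟_)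
open import Data.Fin.Subset using (Subset; _∈_; ∣_∣)
open import Data.Bool using (Bool; true; false; _∧_; _∨_)
open import Data.Bool.Properties using (∨-comm; ∧-comm)
open import Data.Product using (Σ; _×_; _,_; proj₁; proj₂)
open import Relation.Nullary using (¬_; yes; no)
open import Relation.Nullary.Decidable using (⌊_⌋)
open import Relation.Binary.PropositionalEquality using (_≡_; refl; sym; cong; cong₂)

record Graph (n : ℕ) : Set where
  field
    adj    : Fin n → Fin n → Bool
    adj-sym    : ∀ i j → adj i j ≡ adj j i
    adj-irrefl : ∀ i → adj i i ≡ false
open Graph public

data Reach {n : ℕ} (G : Graph n) : Fin n → Fin n → Set where
  here : ∀ {i} → Reach G i i
  step : ∀ {i k j} → adj G i k ≡ true → Reach G k j → Reach G i j

Connected : ∀ {n} → Graph n → Set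
Connected {n} G = ∀ (i j : Fin n) → Reach G i j

Independent : ∀ {n} → Graph n → Subset n → Set
Independent {n} G S = ∀ (i j : Fin n) → i ∈ S → j ∈ S → adj G i j ≡ false

MaxIndependent : ∀ {n} → Graph n → Subset n → Set
MaxIndependent {n} G S =
  Independent G S × (∀ (T : Subset n) → Independent G T → ∣ T ∣ ≤ ∣ S ∣)

IsAlpha : ∀ {n} → Graph n → ℕ → Set
IsAlpha {n} G k =
  Σ (Subset n) (λ S → MaxIndependent G S × ∣ S ∣ ≡ k)

-- Vertex set: Fin (n * m), where the vertex
-- combine u x (decoded by remQuot) is the vertex x of the copy of H attached
-- to u; the vertex (u , v) is identified with the vertex u of G.
-- Edges: x~y in H inside one copy, and (u,v)~(w,v) whenever u~w in G.
private
  eqb : ∀ {k} → Fin k → Fin k → Bool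
  eqb a b = ⌊ a ≟ b ⌋

  eqb-sym : ∀ {k} (a b : Fin k) → eqb a b ≡ eqb b a
  eqb-sym a b with a ≟ b | b ≟ a
  ... | yes _ | yes _ = refl
  ... | no _  | no _  = refl
  ... | yes p | no q  with q (sym p)
  ... | ()
  eqb-sym a b | no q | yes p with q (sym p)
  ... | ()

  eqb-refl : ∀ {k} (a : Fin k) → eqb a a ≡ true
  eqb-refl a with a ≟ a
  ... | yes _ = refl
  ... | no q with q refl
  ... | ()

  cadj : ∀ {n m} → Graph n → Graph m → Fin m → Fin n → Fin n → Fin m → Fin m → Bool
  cadj G H v u w x y = (eqb u w ∧ adj H x y) ∨ ((eqb x v ∧ eqb y v) ∧ adj G u w)

  cadj-sym : ∀ {n m} (G : Graph n) (H : Graph m) v u w x y →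
             cadj G H v u w x y ≡ cadj G H v w u y x
  cadj-sym G H v u w x y =
    cong₂ _∨_ (cong₂ _∧_ (eqb-sym u w) (Graph.adj-sym H x y))
              (cong₂ _∧_ (∧-comm (eqb x v) (eqb y v)) (Graph.adj-sym G u w))

  cadj-irrefl : ∀ {n m} (G : Graph n) (H : Graph m) v u x → cadj G H v u u x x ≡ false
  cadj-irrefl G H v u x rewrite eqb-refl u | Graph.adj-irrefl H x | Graph.adj-irrefl G u
    with eqb x v
  ... | true = refl
  ... | false = refl

copyOf : ∀ {n m} → Fin (n * m) → Fin n
copyOf {n} {m} p = proj₁ (remQuot {n} m p)

vertexOf : ∀ {n m} → Fin (n * m) → Fin m
vertexOf {n} {m} p = proj₂ (remQuot {n} m p)

concatenation : ∀ {n m} → Graph n → Graph m → Fin m → Graph (n * m)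
concatenation {n} {m} G H v = record
  { adj        = λ p q → cadj G H v (copyOf {n} {m} p) (copyOf {n} {m} q)
                                     (vertexOf {n} {m} p) (vertexOf {n} {m} q)
  ; adj-sym    = λ p q → cadj-sym G H v (copyOf {n} {m} p) (copyOf {n} {m} q)
                                        (vertexOf {n} {m} p) (vertexOf {n} {m} q)
  ; adj-irrefl = λ p → cadj-irrefl G H v (copyOf {n} {m} p) (vertexOf {n} {m} p)
  }

-- A subset of G(H,v) is a family of rows, one subset of H per copy, and it is
-- independent exactly when every row is independent in H and the copies whose
-- root v is selected form an independent set of G.  If some maximum independent set T
-- of H avoids v, every row is bounded by α(H) and T in every copy attains n·α(H).
-- If v lies in every maximum independent set, a row avoiding v has size at most
-- α(H) − 1, so the total is at most n·(α(H) − 1) + (number of selected roots)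
-- ≤ n·(α(H) − 1) + α(G); a maximum T ∋ v in the copies indexed by a maximum
-- independent set of G, and T − v in all other copies, attains this.

module Submission where

open import Defs
open import Data.Nat using (ℕ; zero; suc; _*_; _+_; _∸_; _≤_; _<_; z≤n; s≤s; _≤?_)
open import Data.Nat.Properties
  using (+-assoc; +-comm; +-suc; +-identityʳ; +-cancelʳ-≡; +-mono-≤; +-monoʳ-≤; m∸n+n≡m;
         ≤-reflexive; ≤-trans; ≤-antisym; <-≤-trans; <⇒≤pred; ≰⇒>; +-0-commutativeMonoid; module ≤-Reasoning)
open import Data.Fin using (Fin; zero; suc; combine; _≟_)
open import Data.Fin.Properties using (remQuot-combine; combine-remQuot; all?)
open import Data.Fin.Subset using (Subset; _∈_; _∉_; _⊆_; ∣_∣)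
open import Data.Fin.Subset.Properties using (_∈?_; anySubset?; x∈p⇒∣p-x∣<∣p∣)
open import Data.Bool using (Bool; true; false; _∧_; _∨_)
open import Data.Bool.Properties using (∧-zeroʳ; ∨-identityʳ)
import Data.Bool.Properties as Bool
open import Data.Vec using (Vec; []; _∷_; _++_; concat; lookup; tabulate; replicate; map; _[_]≔_; group)
open import Data.Vec.Properties
  using (lookup-concat; lookup-map; lookup-replicate; lookup∘tabulate; lookup∘update; lookup∘update′;
         []=⇒lookup; lookup⇒[]=)
open import Algebra.Properties.CommutativeMonoid.Sum +-0-commutativeMonoid
  using (sum; sum-syntax; sum-cong-≗; ∑-distrib-+)
open import Data.Product using (∃-syntax; _×_; _,_; proj₁; proj₂)
open import Function using (_∘_)
open import Relation.Nullary using (¬_; Dec; yes; no; contradiction)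
open import Relation.Nullary.Decidable using (⌊_⌋; _×-dec_; _→-dec_; ¬?)
open import Relation.Binary.PropositionalEquality

indicator : Bool → ℕ
indicator true  = 1
indicator false = 0

∑-const : ∀ n c → ∑[ i < n ] c ≡ n * c
∑-const zero    c = refl
∑-const (suc n) c = cong (c +_) (∑-const n c)

∑-mono-≤ : ∀ {n} {f g : Fin n → ℕ} → (∀ i → f i ≤ g i) → sum f ≤ sum g
∑-mono-≤ {zero}  f≤g = z≤n
∑-mono-≤ {suc n} f≤g = +-mono-≤ (f≤g zero) (∑-mono-≤ (f≤g ∘ suc))

∣x∷p∣≡indicator[x]+∣p∣ : ∀ {n} x (p : Subset n) → ∣ x ∷ p ∣ ≡ indicator x + ∣ p ∣
∣x∷p∣≡indicator[x]+∣p∣ true  p = refl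
∣x∷p∣≡indicator[x]+∣p∣ false p = refl

∣p∣≡∑indicator : ∀ {n} (p : Subset n) → ∣ p ∣ ≡ ∑[ i < n ] indicator (lookup p i)
∣p∣≡∑indicator []      = refl
∣p∣≡∑indicator (x ∷ p) =
  trans (∣x∷p∣≡indicator[x]+∣p∣ x p) (cong (indicator x +_) (∣p∣≡∑indicator p))

∑[c+indicator]≡n*c+∣p∣ : ∀ {n} c (p : Subset n) →
  ∑[ i < n ] (c + indicator (lookup p i)) ≡ n * c + ∣ p ∣
∑[c+indicator]≡n*c+∣p∣ {n} c p =
  trans (∑-distrib-+ (λ _ → c) (indicator ∘ lookup p))
        (cong₂ _+_ (∑-const n c) (sym (∣p∣≡∑indicator p)))

∣p++q∣≡∣p∣+∣q∣ : ∀ {k l} (p : Subset k) (q : Subset l) → ∣ p ++ q ∣ ≡ ∣ p ∣ + ∣ q ∣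
∣p++q∣≡∣p∣+∣q∣ []          q = refl
∣p++q∣≡∣p∣+∣q∣ (true  ∷ p) q = cong suc (∣p++q∣≡∣p∣+∣q∣ p q)
∣p++q∣≡∣p∣+∣q∣ (false ∷ p) q = ∣p++q∣≡∣p∣+∣q∣ p q

∣concat∣≡∑∣lookup∣ : ∀ {n m} (rows : Vec (Subset m) n) →
  ∣ concat rows ∣ ≡ ∑[ u < n ] ∣ lookup rows u ∣
∣concat∣≡∑∣lookup∣ []         = refl
∣concat∣≡∑∣lookup∣ (r ∷ rows) =
  trans (∣p++q∣≡∣p∣+∣q∣ r (concat rows)) (cong (∣ r ∣ +_) (∣concat∣≡∑∣lookup∣ rows))

∣p[i]≔x∣+[p[i]]≡∣p∣+[x] : ∀ {n} (p : Subset n) i x →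
  ∣ p [ i ]≔ x ∣ + indicator (lookup p i) ≡ ∣ p ∣ + indicator x
∣p[i]≔x∣+[p[i]]≡∣p∣+[x] (true  ∷ p) zero    true  = refl
∣p[i]≔x∣+[p[i]]≡∣p∣+[x] (true  ∷ p) zero    false = +-suc ∣ p ∣ 0
∣p[i]≔x∣+[p[i]]≡∣p∣+[x] (false ∷ p) zero    true  = sym (+-suc ∣ p ∣ 0)
∣p[i]≔x∣+[p[i]]≡∣p∣+[x] (false ∷ p) zero    false = refl
∣p[i]≔x∣+[p[i]]≡∣p∣+[x] (true  ∷ p) (suc i) x     = cong suc (∣p[i]≔x∣+[p[i]]≡∣p∣+[x] p i x)
∣p[i]≔x∣+[p[i]]≡∣p∣+[x] (false ∷ p) (suc i) x     = ∣p[i]≔x∣+[p[i]]≡∣p∣+[x] p i x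

∈⇒0<∣p∣ : ∀ {n} {i : Fin n} {p : Subset n} → i ∈ p → 0 < ∣ p ∣
∈⇒0<∣p∣ i∈p = <-≤-trans (s≤s z≤n) (x∈p⇒∣p-x∣<∣p∣ i∈p)

∈⇒∣p[i]≔x∣≡∣p∣∸1+[x] : ∀ {n} {i : Fin n} {p : Subset n} x → i ∈ p →
  ∣ p [ i ]≔ x ∣ ≡ (∣ p ∣ ∸ 1) + indicator x
∈⇒∣p[i]≔x∣≡∣p∣∸1+[x] {i = i} {p} x i∈p = +-cancelʳ-≡ 1 _ _ (begin
  ∣ p [ i ]≔ x ∣ + 1                    ≡⟨ cong (λ b → ∣ p [ i ]≔ x ∣ + indicator b) ([]=⇒lookup i∈p) ⟨
  ∣ p [ i ]≔ x ∣ + indicator (lookup p i) ≡⟨ ∣p[i]≔x∣+[p[i]]≡∣p∣+[x] p i x ⟩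
  ∣ p ∣ + indicator x                   ≡⟨ cong (_+ indicator x) (m∸n+n≡m (∈⇒0<∣p∣ i∈p)) ⟨
  (∣ p ∣ ∸ 1) + 1 + indicator x         ≡⟨ +-assoc (∣ p ∣ ∸ 1) 1 _ ⟩
  (∣ p ∣ ∸ 1) + (1 + indicator x)       ≡⟨ cong ((∣ p ∣ ∸ 1) +_) (+-comm 1 (indicator x)) ⟩
  (∣ p ∣ ∸ 1) + (indicator x + 1)       ≡⟨ +-assoc (∣ p ∣ ∸ 1) (indicator x) 1 ⟨
  (∣ p ∣ ∸ 1) + indicator x + 1         ∎)
  where open ≡-Reasoning

∈⇒p[i]≔x⊆p : ∀ {n} {i : Fin n} {p : Subset n} x → i ∈ p → p [ i ]≔ x ⊆ p
∈⇒p[i]≔x⊆p {i = i} {p} x i∈p {j} j∈ with j ≟ i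
... | yes refl = i∈p
... | no j≢i   = lookup⇒[]= j p (trans (sym (lookup∘update′ j≢i p x)) ([]=⇒lookup j∈))

independent-⊆ : ∀ {n} (G : Graph n) {p q : Subset n} → p ⊆ q → Independent G q → Independent G p
independent-⊆ G p⊆q indQ i j i∈p j∈p = indQ i j (p⊆q i∈p) (p⊆q j∈p)

independent? : ∀ {n} (G : Graph n) (S : Subset n) → Dec (Independent G S)
independent? G S =
  all? λ i → all? λ j → (i ∈? S) →-dec ((j ∈? S) →-dec (adj G i j Bool.≟ false))

independent⇒∣S∣≤α : ∀ {n} (G : Graph n) {a} {S : Subset n} →
  IsAlpha G a → Independent G S → ∣ S ∣ ≤ a
independent⇒∣S∣≤α G (_ , (_ , maximum) , refl) indS = maximum _ indS

independent∧α≤∣S∣⇒maximum : ∀ {n} (G : Graph n) {a} {S : Subset n} →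
  IsAlpha G a → Independent G S → a ≤ ∣ S ∣ → MaxIndependent G S
independent∧α≤∣S∣⇒maximum G (_ , (_ , maximum) , refl) indS a≤∣S∣ =
  indS , λ T indT → ≤-trans (maximum T indT) a≤∣S∣

mkIsAlpha : ∀ {n} (G : Graph n) {a} (S : Subset n) → Independent G S → ∣ S ∣ ≡ a →
  (∀ T → Independent G T → ∣ T ∣ ≤ a) → IsAlpha G a
mkIsAlpha G S indS refl bound = S , (indS , bound) , refl

InEveryMaximum : ∀ {m} → Graph m → Fin m → Set
InEveryMaximum {m} H v = ∀ (S : Subset m) → MaxIndependent H S → v ∈ S

-- The negated universal is turned into a witness by searching the finitely many subsets.
maximum-avoiding : ∀ {m} (H : Graph m) {v : Fin m} {a} → IsAlpha H a →
  ¬ InEveryMaximum H v → ∃[ T ] (Independent H T × v ∉ T × ∣ T ∣ ≡ a)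
maximum-avoiding H {v} (S₀ , (indS₀ , maximum) , refl) notForced
  with anySubset? (λ T → independent? H T ×-dec ¬? (v ∈? T) ×-dec (∣ S₀ ∣ ≤? ∣ T ∣))
... | yes (T , indT , v∉T , ∣S₀∣≤∣T∣) = T , indT , v∉T , ≤-antisym (maximum T indT) ∣S₀∣≤∣T∣
... | no noneAvoid = contradiction forced notForced
  where
  forced : InEveryMaximum H v
  forced T (indT , maximumT) with v ∈? T
  ... | yes v∈T = v∈T
  ... | no  v∉T = contradiction (T , indT , v∉T , maximumT S₀ indS₀) noneAvoid

forced⇒0<α : ∀ {m} (H : Graph m) {v : Fin m} {a} → IsAlpha H a → InEveryMaximum H v → 0 < a
forced⇒0<α H (S , maximum , refl) forced = ∈⇒0<∣p∣ (forced S maximum)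

forced⇒∣S∣≤α∸1+[v∈S] : ∀ {m} (H : Graph m) {v : Fin m} {a} {S : Subset m} →
  IsAlpha H a → InEveryMaximum H v → Independent H S →
  ∣ S ∣ ≤ (a ∸ 1) + indicator (lookup S v)
forced⇒∣S∣≤α∸1+[v∈S] H {v} {a} {S} α forced indS with lookup S v in S[v]≡
... | true =
  ≤-trans (independent⇒∣S∣≤α H α indS) (≤-reflexive (sym (m∸n+n≡m (forced⇒0<α H α forced))))
... | false = ≤-trans (<⇒≤pred ∣S∣<a) (≤-reflexive (sym (+-identityʳ (a ∸ 1))))
  where
  ∣S∣<a : ∣ S ∣ < a
  ∣S∣<a = ≰⇒> λ a≤∣S∣ → contradiction
    (trans (sym ([]=⇒lookup (forced S (independent∧α≤∣S∣⇒maximum H α indS a≤∣S∣)))) S[v]≡)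
    λ ()

copyOf-combine : ∀ {n m} (u : Fin n) (x : Fin m) → copyOf {n} {m} (combine u x) ≡ u
copyOf-combine u x = cong proj₁ (remQuot-combine u x)

vertexOf-combine : ∀ {n m} (u : Fin n) (x : Fin m) → vertexOf {n} {m} (combine u x) ≡ x
vertexOf-combine u x = cong proj₂ (remQuot-combine u x)

module _ {n m : ℕ} (G : Graph n) (H : Graph m) (v : Fin m) where

  private
    G[H,v] : Graph (n * m)
    G[H,v] = concatenation G H v

  adj-combine : ∀ u w x y →
    adj G[H,v] (combine u x) (combine w y) ≡
    (⌊ u ≟ w ⌋ ∧ adj H x y) ∨ ((⌊ x ≟ v ⌋ ∧ ⌊ y ≟ v ⌋) ∧ adj G u w)
  adj-combine u w x y
    rewrite copyOf-combine {n} {m} u x | copyOf-combine {n} {m} w y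
          | vertexOf-combine {n} {m} u x | vertexOf-combine {n} {m} w y = refl

  adj-combine-copy : ∀ u x y → adj G[H,v] (combine u x) (combine u y) ≡ adj H x y
  adj-combine-copy u x y rewrite adj-combine u u x y | ≡-≟-identity _≟_ {u} refl | adj-irrefl G u =
    trans (cong (adj H x y ∨_) (∧-zeroʳ _)) (∨-identityʳ _)

  adj-combine-root : ∀ u w → adj G[H,v] (combine u v) (combine w v) ≡ adj G u w
  adj-combine-root u w
    rewrite adj-combine u w v v | ≡-≟-identity _≟_ {v} refl | adj-irrefl H v | ∧-zeroʳ ⌊ u ≟ w ⌋ = refl

  independent-on-combine : (S : Subset (n * m)) →
    (∀ u w x y → combine u x ∈ S → combine w y ∈ S → adj G[H,v] (combine u x) (combine w y) ≡ false) →
    Independent G[H,v] S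
  independent-on-combine S indS p q =
    subst₂ (λ p q → p ∈ S → q ∈ S → adj G[H,v] p q ≡ false)
           (combine-remQuot {n} m p) (combine-remQuot {n} m q)
           (indS (copyOf {n} {m} p) (copyOf {n} {m} q) (vertexOf {n} {m} p) (vertexOf {n} {m} q))

  -- A subset of the vertices of G(H,v) is written as concat rows, where row u
  -- lives in copy u; every subset has this form by Data.Vec.group.
  roots : Vec (Subset m) n → Subset n
  roots rows = map (λ row → lookup row v) rows

  module _ (rows : Vec (Subset m) n) where

    combine∈concat⇒∈row : ∀ u x → combine u x ∈ concat rows → x ∈ lookup rows u
    combine∈concat⇒∈row u x ux∈ =
      lookup⇒[]= x _ (trans (sym (lookup-concat rows u x)) ([]=⇒lookup ux∈))

    ∈row⇒combine∈concat : ∀ u x → x ∈ lookup rows u → combine u x ∈ concat rows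
    ∈row⇒combine∈concat u x x∈ =
      lookup⇒[]= (combine u x) _ (trans (lookup-concat rows u x) ([]=⇒lookup x∈))

    ∈roots⇒root∈row : ∀ u → u ∈ roots rows → v ∈ lookup rows u
    ∈roots⇒root∈row u u∈ =
      lookup⇒[]= v _ (trans (sym (lookup-map u _ rows)) ([]=⇒lookup u∈))

    root∈row⇒∈roots : ∀ u → v ∈ lookup rows u → u ∈ roots rows
    root∈row⇒∈roots u v∈ =
      lookup⇒[]= u _ (trans (lookup-map u _ rows) ([]=⇒lookup v∈))

    rows-independent : Independent G[H,v] (concat rows) → ∀ u → Independent H (lookup rows u)
    rows-independent ind u x y x∈ y∈ =
      trans (sym (adj-combine-copy u x y))
            (ind _ _ (∈row⇒combine∈concat u x x∈) (∈row⇒combine∈concat u y y∈))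

    roots-independent : Independent G[H,v] (concat rows) → Independent G (roots rows)
    roots-independent ind u w u∈ w∈ =
      trans (sym (adj-combine-root u w))
            (ind _ _ (∈row⇒combine∈concat u v (∈roots⇒root∈row u u∈))
                     (∈row⇒combine∈concat w v (∈roots⇒root∈row w w∈)))

    concat-independent : (∀ u → Independent H (lookup rows u)) → Independent G (roots rows) →
      Independent G[H,v] (concat rows)
    concat-independent indRows indRoots = independent-on-combine (concat rows) λ u w x y ux∈ wy∈ →
      trans (adj-combine u w x y)
            (cong₂ _∨_ (inside-copy u w x y (combine∈concat⇒∈row u x ux∈) (combine∈concat⇒∈row w y wy∈))
                       (between-roots u w x y (combine∈concat⇒∈row u x ux∈) (combine∈concat⇒∈row w y wy∈)))
      where
      inside-copy : ∀ u w x y → x ∈ lookup rows u → y ∈ lookup rows w → ⌊ u ≟ w ⌋ ∧ adj H x y ≡ false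
      inside-copy u w x y x∈ y∈ with u ≟ w
      ... | yes refl = indRows u x y x∈ y∈
      ... | no  _    = refl

      between-roots : ∀ u w x y → x ∈ lookup rows u → y ∈ lookup rows w →
        (⌊ x ≟ v ⌋ ∧ ⌊ y ≟ v ⌋) ∧ adj G u w ≡ false
      between-roots u w x y x∈ y∈ with x ≟ v | y ≟ v
      ... | yes refl | yes refl = indRoots u w (root∈row⇒∈roots u x∈) (root∈row⇒∈roots w y∈)
      ... | yes _    | no  _    = refl
      ... | no  _    | _        = refl

  ∣S∣≤n*α : ∀ {a} → IsAlpha H a → ∀ S → Independent G[H,v] S → ∣ S ∣ ≤ n * a
  ∣S∣≤n*α {a} αH S indS with group n m S
  ... | rows , refl = begin
    ∣ concat rows ∣               ≡⟨ ∣concat∣≡∑∣lookup∣ rows ⟩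
    ∑[ u < n ] ∣ lookup rows u ∣  ≤⟨ ∑-mono-≤ (λ u → independent⇒∣S∣≤α H αH (rows-independent rows indS u)) ⟩
    ∑[ u < n ] a                  ≡⟨ ∑-const n a ⟩
    n * a                         ∎
    where open ≤-Reasoning

  forced⇒∣S∣≤n*[α∸1]+β : ∀ {a b} → IsAlpha H a → IsAlpha G b → InEveryMaximum H v →
    ∀ S → Independent G[H,v] S → ∣ S ∣ ≤ n * (a ∸ 1) + b
  forced⇒∣S∣≤n*[α∸1]+β {a} {b} αH αG forced S indS with group n m S
  ... | rows , refl = begin
    ∣ concat rows ∣
      ≡⟨ ∣concat∣≡∑∣lookup∣ rows ⟩
    ∑[ u < n ] ∣ lookup rows u ∣
      ≤⟨ ∑-mono-≤ (λ u → forced⇒∣S∣≤α∸1+[v∈S] H αH forced (rows-independent rows indS u)) ⟩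
    ∑[ u < n ] ((a ∸ 1) + indicator (lookup (lookup rows u) v))
      ≡⟨ sum-cong-≗ (λ u → cong (λ b → (a ∸ 1) + indicator b) (lookup-map u _ rows)) ⟨
    ∑[ u < n ] ((a ∸ 1) + indicator (lookup (roots rows) u))
      ≡⟨ ∑[c+indicator]≡n*c+∣p∣ (a ∸ 1) (roots rows) ⟩
    n * (a ∸ 1) + ∣ roots rows ∣
      ≤⟨ +-monoʳ-≤ (n * (a ∸ 1)) (independent⇒∣S∣≤α G αG (roots-independent rows indS)) ⟩
    n * (a ∸ 1) + b
      ∎
    where open ≤-Reasoning

  α-concatenation-unforced : ¬ InEveryMaximum H v → ∀ a → IsAlpha H a → IsAlpha G[H,v] (n * a)
  α-concatenation-unforced notForced a αH with maximum-avoiding H αH notForced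
  ... | T , indT , v∉T , ∣T∣≡a = mkIsAlpha G[H,v] (concat rows) indS size (∣S∣≤n*α αH)
    where
    rows : Vec (Subset m) n
    rows = replicate n T

    row≡T : ∀ u → lookup rows u ≡ T
    row≡T u = lookup-replicate u T

    indS : Independent G[H,v] (concat rows)
    indS = concat-independent rows (λ u → subst (Independent H) (sym (row≡T u)) indT)
      λ u _ u∈ _ → contradiction (subst (v ∈_) (row≡T u) (∈roots⇒root∈row rows u u∈)) v∉T

    size : ∣ concat rows ∣ ≡ n * a
    size = begin
      ∣ concat rows ∣               ≡⟨ ∣concat∣≡∑∣lookup∣ rows ⟩
      ∑[ u < n ] ∣ lookup rows u ∣  ≡⟨ sum-cong-≗ (λ u → trans (cong ∣_∣ (row≡T u)) ∣T∣≡a) ⟩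
      ∑[ u < n ] a                  ≡⟨ ∑-const n a ⟩
      n * a                         ∎
      where open ≡-Reasoning

  α-concatenation-forced : InEveryMaximum H v → ∀ a b → IsAlpha H a → IsAlpha G b →
    IsAlpha G[H,v] (n * (a ∸ 1) + b)
  α-concatenation-forced forced _ _ αH@(T , maxT , refl) αG@(B , (indB , _) , refl) =
    mkIsAlpha G[H,v] (concat rows) indS size (forced⇒∣S∣≤n*[α∸1]+β αH αG forced)
    where
    v∈T : v ∈ T
    v∈T = forced T maxT

    rows : Vec (Subset m) n
    rows = tabulate (λ u → T [ v ]≔ lookup B u)

    row≡ : ∀ u → lookup rows u ≡ T [ v ]≔ lookup B u
    row≡ = lookup∘tabulate _

    roots⊆B : roots rows ⊆ B
    roots⊆B {u} u∈ = lookup⇒[]= u B (begin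
      lookup B u                          ≡⟨ lookup∘update v T (lookup B u) ⟨
      lookup (T [ v ]≔ lookup B u) v      ≡⟨ cong (λ row → lookup row v) (row≡ u) ⟨
      lookup (lookup rows u) v            ≡⟨ []=⇒lookup (∈roots⇒root∈row rows u u∈) ⟩
      true                                ∎)
      where open ≡-Reasoning

    indS : Independent G[H,v] (concat rows)
    indS = concat-independent rows
      (λ u → subst (Independent H) (sym (row≡ u)) (independent-⊆ H (∈⇒p[i]≔x⊆p _ v∈T) (proj₁ maxT)))
      (independent-⊆ G roots⊆B indB)

    size : ∣ concat rows ∣ ≡ n * (∣ T ∣ ∸ 1) + ∣ B ∣
    size = begin
      ∣ concat rows ∣
        ≡⟨ ∣concat∣≡∑∣lookup∣ rows ⟩
      ∑[ u < n ] ∣ lookup rows u ∣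
        ≡⟨ sum-cong-≗ (λ u → trans (cong ∣_∣ (row≡ u)) (∈⇒∣p[i]≔x∣≡∣p∣∸1+[x] _ v∈T)) ⟩
      ∑[ u < n ] ((∣ T ∣ ∸ 1) + indicator (lookup B u))
        ≡⟨ ∑[c+indicator]≡n*c+∣p∣ (∣ T ∣ ∸ 1) B ⟩
      n * (∣ T ∣ ∸ 1) + ∣ B ∣
        ∎
      where open ≡-Reasoning

lemma4p9 : ∀ {n m : ℕ} (G : Graph n) (H : Graph m) (v : Fin m) →
    2 ≤ n → Connected G → 2 ≤ m →
    ((¬ (∀ (S : Subset m) → MaxIndependent H S → v ∈ S)) →
       ∀ (a : ℕ) → IsAlpha H a → IsAlpha (concatenation G H v) (n * a))
    ×
    ((∀ (S : Subset m) → MaxIndependent H S → v ∈ S) →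
       ∀ (a b : ℕ) → IsAlpha H a → IsAlpha G b →
         IsAlpha (concatenation G H v) (n * (a ∸ 1) + b))
lemma4p9 G H v _ _ _ = α-concatenation-unforced G H v , α-concatenation-forced G H v
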